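{- Let $J$ be an IMV-algebra. For $x,y\in J$ let $x\cup y$ be the unique element of $J$ with $\gamma_J(x\cup y)=[\Delta x\wedge\Delta y,\ \nabla x\vee\nabla y]$, where $\wedge,\vee$ are the lattice operations of the MV-algebra $\mathcal C(J)$. Then: (i) $(J,\cup)$ is a sup-semilattice with maximum element $\iota$, whose set of minimal elements coincides with the center $C(J)$; (iii) denoting by $\subseteq$ the resulting partial order ($x\subseteq y$ iff $x\cup y=y$), $\oplus$ and $\odot$ are monotone in both arguments, $\neg$ is monotone, and $\Delta x\subseteq x\supseteq\nabla x$ for all $x$; (iv) $x\cup y=\zeta(\Delta x\boldsymbol\wedge\Delta y,\ \nabla x\boldsymbol\vee\nabla y)$ for all $x,y\in J$, where $\zeta(u,v)=\Delta u\oplus(\iota\odot\nabla v\odot\neg\Delta u)$, $u\boldsymbol\wedge v=\neg(\neg u\odot v)\odot v$ and $u\boldsymbol\vee v=\neg(\neg u\oplus v)\oplus v$; (vi) for all $x,y\in J$: $x\subseteq y$ iff $x\cup y=y$ iff ($\Delta y\leq\Delta x$ and $\nabla x\leq\nabla y$ in the MV-algebra $\mathcal C(J)$) iff $(\neg\Delta y\oplus\Delta x)\odot(\neg\nabla x\oplus\nabla y)=1$ in $J$.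
   Context: An IMV-algebra is an algebra $J=(J,0,1,\iota,\neg,\Delta,\nabla,\oplus,\odot)$ of type $(0,0,0,1,1,1,2,2)$ satisfying the equations: $x\oplus(y\oplus z)=(x\oplus y)\oplus z$; $x\oplus y=y\oplus x$; $x\oplus 0=x$; $x\oplus\neg 0=\neg 0$; $\neg\neg x=x$; $\neg(\neg\Delta x\oplus\Delta y)\oplus\Delta y=\neg(\neg\Delta y\oplus\Delta x)\oplus\Delta x$; $x\odot y=\neg(\neg x\oplus\neg y)$; $1=\neg 0$; $\nabla x=\neg\Delta\neg x$; $\neg\iota=\iota$; $\Delta 0=0$; $\Delta 1=1$; $\Delta\iota=0$; $\Delta\Delta x=\Delta x$; $\Delta\nabla x=\nabla x$; $\Delta(x\oplus y)=\Delta x\oplus\Delta y$; $\Delta(x\odot y)=\Delta x\odot\Delta y$; $\Delta x\odot\neg\nabla x=0$; $\Delta x\oplus(\iota\odot\nabla x\odot\neg\Delta x)=x$. The center is $C(J)=\{x\in J\mid\Delta x=\nabla x\}$; $\mathcal C(J)=(C(J),0,1,\neg,\oplus,\odot)$ is an MV-algebra with natural order $\leq$ and lattice operations $\wedge,\vee$. For an MV-algebra $A$, $\mathcal I(A)$ is its algebra of intervals $[\alpha,\beta]$ ($\alpha\leq\beta$) with $0=[0,0]$, $1=[1,1]$, $\iota=A$, pointwise $\neg,\odot$, Minkowski $\oplus$, $\Delta[\alpha,\beta]=[\alpha,\alpha]$, $\nabla[\alpha,\beta]=[\beta,\beta]$. The map $\gamma_J\colon J\to\mathcal I(\mathcal C(J))$,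 $\gamma_J(x)=[\Delta x,\nabla x]$, is an isomorphism (so $J$ is identified with $\mathcal I(\mathcal C(J))$ and $x\cup y$ is well defined; it corresponds to the union-hull of two intervals, and $\subseteq$ to inclusion of intervals). -}

module Defs where

open import Level using (Level; suc)
open import Relation.Binary.PropositionalEquality using (_≡_)
open import Data.Product using (_×_)

record IMVAlgebra (a : Level) : Set (suc a) where
  infixl 6 _⊕_
  infixl 7 _⊙_
  infix 8 ¬_
  field
    Carrier : Set a
    𝟘 𝟙 ι : Carrier
    ¬_ Δ ∇ : Carrier → Carrier
    _⊕_ _⊙_ : Carrier → Carrier → Carrier
    ⊕-assoc : ∀ x y z → x ⊕ (y ⊕ z) ≡ (x ⊕ y) ⊕ z
    ⊕-comm : ∀ x y → x ⊕ y ≡ y ⊕ x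
    ⊕-identity : ∀ x → x ⊕ 𝟘 ≡ x
    ⊕-absorb : ∀ x → x ⊕ (¬ 𝟘) ≡ ¬ 𝟘
    ¬¬ : ∀ x → ¬ (¬ x) ≡ x
    luk : ∀ x y → ¬ (¬ (Δ x) ⊕ Δ y) ⊕ Δ y ≡ ¬ (¬ (Δ y) ⊕ Δ x) ⊕ Δ x
    ⊙-def : ∀ x y → x ⊙ y ≡ ¬ (¬ x ⊕ ¬ y)
    𝟙-def : 𝟙 ≡ ¬ 𝟘
    ∇-def : ∀ x → ∇ x ≡ ¬ (Δ (¬ x))
    ¬ι : ¬ ι ≡ ι
    Δ𝟘 : Δ 𝟘 ≡ 𝟘
    Δ𝟙 : Δ 𝟙 ≡ 𝟙
    Δι : Δ ι ≡ 𝟘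
    ΔΔ : ∀ x → Δ (Δ x) ≡ Δ x
    Δ∇ : ∀ x → Δ (∇ x) ≡ ∇ x
    Δ-⊕ : ∀ x y → Δ (x ⊕ y) ≡ Δ x ⊕ Δ y
    Δ-⊙ : ∀ x y → Δ (x ⊙ y) ≡ Δ x ⊙ Δ y
    Δ⊙¬∇ : ∀ x → Δ x ⊙ ¬ (∇ x) ≡ 𝟘
    decomp : ∀ x → Δ x ⊕ (ι ⊙ ∇ x ⊙ ¬ (Δ x)) ≡ x

module IMVOps {a : Level} (J : IMVAlgebra a) where
  open IMVAlgebra J
  infixl 6 _∨_ _⋁_
  infixl 7 _∧_ _⋀_
  infix 4 _≤_

  InCenter : Carrier → Set a
  InCenter x = Δ x ≡ ∇ x

  -- lattice operations and natural order of the MV-algebra 𝒞(J)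
  -- (Chang / Cignoli–D'Ottaviano–Mundici conventions)
  _∨_ : Carrier → Carrier → Carrier
  x ∨ y = ¬ (¬ x ⊕ y) ⊕ y

  _∧_ : Carrier → Carrier → Carrier
  x ∧ y = ¬ (¬ x ∨ ¬ y)

  _≤_ : Carrier → Carrier → Set a
  x ≤ y = ¬ x ⊕ y ≡ 𝟙

  _⋀_ : Carrier → Carrier → Carrier
  u ⋀ v = ¬ (¬ u ⊙ v) ⊙ v

  _⋁_ : Carrier → Carrier → Carrier
  u ⋁ v = ¬ (¬ u ⊕ v) ⊕ v

  ζ : Carrier → Carrier → Carrier
  ζ u v = Δ u ⊕ (ι ⊙ ∇ v ⊙ ¬ (Δ u))

  -- an operation _∪_ is "the" union: γ_J (x ∪ y) = [Δx ∧ Δy , ∇x ∨ ∇y]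
  IsUnion : (Carrier → Carrier → Carrier) → Set a
  IsUnion _∪_ = ∀ x y → (Δ (x ∪ y) ≡ Δ x ∧ Δ y) × (∇ (x ∪ y) ≡ ∇ x ∨ ∇ y)

  module WithUnion (_∪_ : Carrier → Carrier → Carrier) where
    infix 4 _⊆_
    _⊆_ : Carrier → Carrier → Set a
    x ⊆ y = x ∪ y ≡ y

    IsMinimal : Carrier → Set a
    IsMinimal x = ∀ y → y ⊆ x → y ≡ x

module Submission where

-- By the decomposition axiom an element x is determined by the pair (Δ x, ∇ x), an interval
-- of the center, so x ∪ y = y says exactly that the interval of x lies inside that of y.
-- Every claim about ∪ and ⊆ thus reduces to a fact about the lattice reduct of the
-- MV-algebra of central elements, where the Łukasiewicz axiom (luk) makes ∨ commutative and
-- the natural order a lattice order; Δ and ∇ preserve ⊕, ⊙ and swap under ¬, which gives the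
-- monotonicity of the operations.

open import Defs
open import Level using (Level)
open import Relation.Binary.PropositionalEquality using (_≡_; sym; trans; cong; cong₂; subst; subst₂; module ≡-Reasoning)
open import Data.Product using (_×_; _,_; proj₁; proj₂)
open import Function.Base using (id)
open import Function.Bundles using (_⇔_; mk⇔)

module Properties {a : Level} (J : IMVAlgebra a) where
  open IMVAlgebra J
  open IMVOps J
  open ≡-Reasoning

  ¬𝟘 : ¬ 𝟘 ≡ 𝟙
  ¬𝟘 = sym 𝟙-def

  ¬𝟙 : ¬ 𝟙 ≡ 𝟘
  ¬𝟙 = trans (cong ¬_ 𝟙-def) (¬¬ 𝟘)

  ⊕-identityˡ : ∀ x → 𝟘 ⊕ x ≡ x
  ⊕-identityˡ x = trans (⊕-comm 𝟘 x) (⊕-identity x)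

  ⊕-zeroʳ : ∀ x → x ⊕ 𝟙 ≡ 𝟙
  ⊕-zeroʳ x = trans (cong (x ⊕_) 𝟙-def) (trans (⊕-absorb x) ¬𝟘)

  ⊕-zeroˡ : ∀ x → 𝟙 ⊕ x ≡ 𝟙
  ⊕-zeroˡ x = trans (⊕-comm 𝟙 x) (⊕-zeroʳ x)

  ¬-⊙ : ∀ x y → ¬ (x ⊙ y) ≡ ¬ x ⊕ ¬ y
  ¬-⊙ x y = trans (cong ¬_ (⊙-def x y)) (¬¬ _)

  ¬-⊕ : ∀ x y → ¬ (x ⊕ y) ≡ ¬ x ⊙ ¬ y
  ¬-⊕ x y = trans (cong₂ (λ p q → ¬ (p ⊕ q)) (sym (¬¬ x)) (sym (¬¬ y))) (sym (⊙-def (¬ x) (¬ y)))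

  ⊙-comm : ∀ x y → x ⊙ y ≡ y ⊙ x
  ⊙-comm x y = trans (⊙-def x y) (trans (cong ¬_ (⊕-comm (¬ x) (¬ y))) (sym (⊙-def y x)))

  ⊙-identityʳ : ∀ x → x ⊙ 𝟙 ≡ x
  ⊙-identityʳ x = begin
    x ⊙ 𝟙            ≡⟨ ⊙-def x 𝟙 ⟩
    ¬ (¬ x ⊕ ¬ 𝟙)    ≡⟨ cong (λ t → ¬ (¬ x ⊕ t)) ¬𝟙 ⟩
    ¬ (¬ x ⊕ 𝟘)      ≡⟨ cong ¬_ (⊕-identity (¬ x)) ⟩
    ¬ ¬ x            ≡⟨ ¬¬ x ⟩
    x                ∎

  Δ-¬ : ∀ x → Δ (¬ x) ≡ ¬ ∇ x
  Δ-¬ x = sym (trans (cong ¬_ (∇-def x)) (¬¬ _))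

  ∇-¬ : ∀ x → ∇ (¬ x) ≡ ¬ Δ x
  ∇-¬ x = trans (∇-def (¬ x)) (cong (λ t → ¬ Δ t) (¬¬ x))

  ∇-⊕ : ∀ x y → ∇ (x ⊕ y) ≡ ∇ x ⊕ ∇ y
  ∇-⊕ x y = begin
    ∇ (x ⊕ y)             ≡⟨ ∇-def _ ⟩
    ¬ Δ (¬ (x ⊕ y))       ≡⟨ cong (λ t → ¬ Δ t) (¬-⊕ x y) ⟩
    ¬ Δ (¬ x ⊙ ¬ y)       ≡⟨ cong ¬_ (Δ-⊙ _ _) ⟩
    ¬ (Δ (¬ x) ⊙ Δ (¬ y)) ≡⟨ ¬-⊙ _ _ ⟩
    ¬ Δ (¬ x) ⊕ ¬ Δ (¬ y) ≡⟨ cong₂ _⊕_ (∇-def x) (∇-def y) ⟨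
    ∇ x ⊕ ∇ y             ∎

  ∇-⊙ : ∀ x y → ∇ (x ⊙ y) ≡ ∇ x ⊙ ∇ y
  ∇-⊙ x y = begin
    ∇ (x ⊙ y)             ≡⟨ ∇-def _ ⟩
    ¬ Δ (¬ (x ⊙ y))       ≡⟨ cong (λ t → ¬ Δ t) (¬-⊙ x y) ⟩
    ¬ Δ (¬ x ⊕ ¬ y)       ≡⟨ cong ¬_ (Δ-⊕ _ _) ⟩
    ¬ (Δ (¬ x) ⊕ Δ (¬ y)) ≡⟨ ¬-⊕ _ _ ⟩
    ¬ Δ (¬ x) ⊙ ¬ Δ (¬ y) ≡⟨ cong₂ _⊙_ (∇-def x) (∇-def y) ⟨
    ∇ x ⊙ ∇ y             ∎

  ∇ι : ∇ ι ≡ 𝟙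
  ∇ι = begin
    ∇ ι       ≡⟨ ∇-def ι ⟩
    ¬ Δ (¬ ι) ≡⟨ cong (λ t → ¬ Δ t) ¬ι ⟩
    ¬ Δ ι     ≡⟨ cong ¬_ Δι ⟩
    ¬ 𝟘       ≡⟨ ¬𝟘 ⟩
    𝟙         ∎

  Δ∇-injective : ∀ {x y} → Δ x ≡ Δ y → ∇ x ≡ ∇ y → x ≡ y
  Δ∇-injective {x} {y} Δx≡Δy ∇x≡∇y = begin
    x                             ≡⟨ decomp x ⟨
    Δ x ⊕ (ι ⊙ ∇ x ⊙ ¬ Δ x)       ≡⟨ cong₂ (λ p q → p ⊕ (ι ⊙ q ⊙ ¬ p)) Δx≡Δy ∇x≡∇y ⟩
    Δ y ⊕ (ι ⊙ ∇ y ⊙ ¬ Δ y)       ≡⟨ decomp y ⟩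
    y                             ∎

  -- The center C(J), presented as the image of Δ: both ΔΔ x and Δ∇ x then say
  -- that Δ x and ∇ x are central.
  Central : Carrier → Set a
  Central x = Δ x ≡ x

  central-¬ : ∀ {x} → Central x → Central (¬ x)
  central-¬ {x} Δx≡x = subst (λ t → Δ (¬ t) ≡ ¬ t) Δx≡x (begin
    Δ (¬ Δ x)   ≡⟨ cong Δ (∇-¬ x) ⟨
    Δ (∇ (¬ x)) ≡⟨ Δ∇ (¬ x) ⟩
    ∇ (¬ x)     ≡⟨ ∇-¬ x ⟩
    ¬ Δ x       ∎)

  central-⊕ : ∀ {x y} → Central x → Central y → Central (x ⊕ y)
  central-⊕ {x} {y} cx cy = trans (Δ-⊕ x y) (cong₂ _⊕_ cx cy)

  central-∨ : ∀ {x y} → Central x → Central y → Central (x ∨ y)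
  central-∨ cx cy = central-⊕ (central-¬ (central-⊕ (central-¬ cx) cy)) cy

  central-∧ : ∀ {x y} → Central x → Central y → Central (x ∧ y)
  central-∧ cx cy = central-¬ (central-∨ (central-¬ cx) (central-¬ cy))

  central⇒∇≡ : ∀ {x} → Central x → ∇ x ≡ x
  central⇒∇≡ {x} cx = trans (∇-def x) (trans (cong ¬_ (central-¬ cx)) (¬¬ x))

  ∨-comm : ∀ {x y} → Central x → Central y → x ∨ y ≡ y ∨ x
  ∨-comm {x} {y} cx cy = subst₂ (λ s t → ¬ (¬ s ⊕ t) ⊕ t ≡ ¬ (¬ t ⊕ s) ⊕ s) cx cy (luk x y)

  ¬x⊕x≡𝟙 : ∀ {x} → Central x → ¬ x ⊕ x ≡ 𝟙
  ¬x⊕x≡𝟙 {x} cx = begin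
    ¬ x ⊕ x           ≡⟨ cong (λ t → ¬ t ⊕ x) (⊕-identityˡ x) ⟨
    ¬ (𝟘 ⊕ x) ⊕ x     ≡⟨ cong (λ t → ¬ (t ⊕ x) ⊕ x) ¬𝟙 ⟨
    𝟙 ∨ x             ≡⟨ ∨-comm Δ𝟙 cx ⟩
    x ∨ 𝟙             ≡⟨ ⊕-zeroʳ _ ⟩
    𝟙                 ∎

  x≤x⊕y : ∀ {x} → Central x → ∀ y → x ≤ x ⊕ y
  x≤x⊕y {x} cx y = begin
    ¬ x ⊕ (x ⊕ y) ≡⟨ ⊕-assoc _ _ _ ⟩
    (¬ x ⊕ x) ⊕ y ≡⟨ cong (_⊕ y) (¬x⊕x≡𝟙 cx) ⟩
    𝟙 ⊕ y         ≡⟨ ⊕-zeroˡ y ⟩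
    𝟙             ∎

  ≤-refl : ∀ {x} → Central x → x ≤ x
  ≤-refl = ¬x⊕x≡𝟙

  Δ≤∇ : ∀ x → Δ x ≤ ∇ x
  Δ≤∇ x = begin
    ¬ Δ x ⊕ ∇ x     ≡⟨ cong (¬ Δ x ⊕_) (¬¬ _) ⟨
    ¬ Δ x ⊕ ¬ ¬ ∇ x ≡⟨ ¬-⊙ _ _ ⟨
    ¬ (Δ x ⊙ ¬ ∇ x) ≡⟨ cong ¬_ (Δ⊙¬∇ x) ⟩
    ¬ 𝟘             ≡⟨ ¬𝟘 ⟩
    𝟙               ∎

  x≤y⇒x∨y≡y : ∀ {x y} → x ≤ y → x ∨ y ≡ y
  x≤y⇒x∨y≡y {x} {y} x≤y = begin
    ¬ (¬ x ⊕ y) ⊕ y ≡⟨ cong (λ t → ¬ t ⊕ y) x≤y ⟩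
    ¬ 𝟙 ⊕ y         ≡⟨ cong (_⊕ y) ¬𝟙 ⟩
    𝟘 ⊕ y           ≡⟨ ⊕-identityˡ y ⟩
    y               ∎

  x≤y⇒y≡x⊕w : ∀ {x y} → Central x → Central y → x ≤ y → y ≡ x ⊕ ¬ (¬ y ⊕ x)
  x≤y⇒y≡x⊕w cx cy x≤y = trans (sym (x≤y⇒x∨y≡y x≤y)) (trans (∨-comm cx cy) (⊕-comm _ _))

  x∨y≡y⇒x≤y : ∀ {x y} → Central x → Central y → x ∨ y ≡ y → x ≤ y
  x∨y≡y⇒x≤y {x} {y} cx cy x∨y≡y =
    subst (x ≤_) (trans (⊕-comm _ _) (trans (∨-comm cy cx) x∨y≡y)) (x≤x⊕y cx _)

  ≤-trans : ∀ {x y z} → Central x → Central y → Central z → x ≤ y → y ≤ z → x ≤ z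
  ≤-trans {x} {y} {z} cx cy cz x≤y y≤z = subst (x ≤_) (sym z≡x⊕v) (x≤x⊕y cx _)
    where
      u = ¬ (¬ y ⊕ x)
      w = ¬ (¬ z ⊕ y)
      z≡x⊕v : z ≡ x ⊕ (u ⊕ w)
      z≡x⊕v = begin
        z             ≡⟨ x≤y⇒y≡x⊕w cy cz y≤z ⟩
        y ⊕ w         ≡⟨ cong (_⊕ w) (x≤y⇒y≡x⊕w cx cy x≤y) ⟩
        (x ⊕ u) ⊕ w   ≡⟨ ⊕-assoc x u w ⟨
        x ⊕ (u ⊕ w)   ∎

  ≤-antisym : ∀ {x y} → Central x → Central y → x ≤ y → y ≤ x → x ≡ y
  ≤-antisym cx cy x≤y y≤x = trans (sym (x≤y⇒x∨y≡y y≤x)) (trans (∨-comm cy cx) (x≤y⇒x∨y≡y x≤y))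

  ¬-antitone : ∀ {x y} → x ≤ y → ¬ y ≤ ¬ x
  ¬-antitone {x} {y} x≤y = trans (cong (_⊕ ¬ x) (¬¬ y)) (trans (⊕-comm y (¬ x)) x≤y)

  ¬-reflects-≤ : ∀ {x y} → ¬ y ≤ ¬ x → x ≤ y
  ¬-reflects-≤ {x} {y} ¬y≤¬x = subst₂ _≤_ (¬¬ x) (¬¬ y) (¬-antitone ¬y≤¬x)

  ⊕-monoˡ-≤ : ∀ {x y z} → Central x → Central y → Central z → x ≤ y → x ⊕ z ≤ y ⊕ z
  ⊕-monoˡ-≤ {x} {y} {z} cx cy cz x≤y = subst (x ⊕ z ≤_) (sym y⊕z≡x⊕z⊕w) (x≤x⊕y (central-⊕ cx cz) w)
    where
      w = ¬ (¬ y ⊕ x)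
      y⊕z≡x⊕z⊕w : y ⊕ z ≡ (x ⊕ z) ⊕ w
      y⊕z≡x⊕z⊕w = begin
        y ⊕ z         ≡⟨ cong (_⊕ z) (x≤y⇒y≡x⊕w cx cy x≤y) ⟩
        (x ⊕ w) ⊕ z   ≡⟨ ⊕-assoc x w z ⟨
        x ⊕ (w ⊕ z)   ≡⟨ cong (x ⊕_) (⊕-comm w z) ⟩
        x ⊕ (z ⊕ w)   ≡⟨ ⊕-assoc x z w ⟩
        (x ⊕ z) ⊕ w   ∎

  ⊕-mono-≤ : ∀ {x x′ y y′} → Central x → Central x′ → Central y → Central y′ →
             x ≤ x′ → y ≤ y′ → x ⊕ y ≤ x′ ⊕ y′
  ⊕-mono-≤ {x} {x′} {y} {y′} cx cx′ cy cy′ x≤x′ y≤y′ =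
    ≤-trans (central-⊕ cx cy) (central-⊕ cx′ cy) (central-⊕ cx′ cy′)
      (⊕-monoˡ-≤ cx cx′ cy x≤x′)
      (subst₂ _≤_ (⊕-comm y x′) (⊕-comm y′ x′) (⊕-monoˡ-≤ cy cy′ cx′ y≤y′))

  ⊙-mono-≤ : ∀ {x x′ y y′} → Central x → Central x′ → Central y → Central y′ →
             x ≤ x′ → y ≤ y′ → x ⊙ y ≤ x′ ⊙ y′
  ⊙-mono-≤ {x} {x′} {y} {y′} cx cx′ cy cy′ x≤x′ y≤y′ =
    subst₂ _≤_ (sym (⊙-def x y)) (sym (⊙-def x′ y′))
      (¬-antitone (⊕-mono-≤ (central-¬ cx′) (central-¬ cx) (central-¬ cy′) (central-¬ cy)
                            (¬-antitone x≤x′) (¬-antitone y≤y′)))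

  y≤x∨y : ∀ {x y} → Central y → y ≤ x ∨ y
  y≤x∨y {x} {y} cy = subst (y ≤_) (⊕-comm _ _) (x≤x⊕y cy _)

  x≤x∨y : ∀ {x y} → Central x → Central y → x ≤ x ∨ y
  x≤x∨y {x} cx cy = subst (x ≤_) (∨-comm cy cx) (y≤x∨y cx)

  ∨-monoˡ-≤ : ∀ {x y z} → Central x → Central y → Central z → x ≤ z → x ∨ y ≤ z ∨ y
  ∨-monoˡ-≤ cx cy cz x≤z =
    ⊕-monoˡ-≤ (central-¬ (central-⊕ (central-¬ cx) cy)) (central-¬ (central-⊕ (central-¬ cz) cy)) cy
      (¬-antitone (⊕-monoˡ-≤ (central-¬ cz) (central-¬ cx) cy (¬-antitone x≤z)))

  ∨-least : ∀ {x y z} → Central x → Central y → Central z → x ≤ z → y ≤ z → x ∨ y ≤ z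
  ∨-least {x} cx cy cz x≤z y≤z =
    subst (x ∨ _ ≤_) (trans (∨-comm cz cy) (x≤y⇒x∨y≡y y≤z)) (∨-monoˡ-≤ cx cy cz x≤z)

  ∨-assoc : ∀ {x y z} → Central x → Central y → Central z → x ∨ (y ∨ z) ≡ (x ∨ y) ∨ z
  ∨-assoc cx cy cz = ≤-antisym cl cr
    (∨-least cx cyz cr
      (≤-trans cx cxy cr (x≤x∨y cx cy) (x≤x∨y cxy cz))
      (∨-least cy cz cr (≤-trans cy cxy cr (y≤x∨y cy) (x≤x∨y cxy cz)) (y≤x∨y cz)))
    (∨-least cxy cz cl
      (∨-least cx cy cl (x≤x∨y cx cyz) (≤-trans cy cyz cl (x≤x∨y cy cz) (y≤x∨y cyz)))
      (≤-trans cz cyz cl (y≤x∨y cz) (y≤x∨y cyz)))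
    where
      cyz = central-∨ cy cz
      cxy = central-∨ cx cy
      cl = central-∨ cx cyz
      cr = central-∨ cxy cz

  ∨-idem : ∀ {x} → Central x → x ∨ x ≡ x
  ∨-idem cx = x≤y⇒x∨y≡y (≤-refl cx)

  ∨-zeroʳ : ∀ x → x ∨ 𝟙 ≡ 𝟙
  ∨-zeroʳ x = ⊕-zeroʳ _

  ∧-comm : ∀ {x y} → Central x → Central y → x ∧ y ≡ y ∧ x
  ∧-comm cx cy = cong ¬_ (∨-comm (central-¬ cx) (central-¬ cy))

  ∧-assoc : ∀ {x y z} → Central x → Central y → Central z → x ∧ (y ∧ z) ≡ (x ∧ y) ∧ z
  ∧-assoc {x} {y} {z} cx cy cz = begin
    ¬ (¬ x ∨ ¬ ¬ (¬ y ∨ ¬ z)) ≡⟨ cong (λ t → ¬ (¬ x ∨ t)) (¬¬ _) ⟩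
    ¬ (¬ x ∨ (¬ y ∨ ¬ z))     ≡⟨ cong ¬_ (∨-assoc (central-¬ cx) (central-¬ cy) (central-¬ cz)) ⟩
    ¬ ((¬ x ∨ ¬ y) ∨ ¬ z)     ≡⟨ cong (λ t → ¬ (t ∨ ¬ z)) (¬¬ _) ⟨
    ¬ (¬ ¬ (¬ x ∨ ¬ y) ∨ ¬ z) ∎

  ∧-idem : ∀ {x} → Central x → x ∧ x ≡ x
  ∧-idem {x} cx = trans (cong ¬_ (∨-idem (central-¬ cx))) (¬¬ x)

  y≤x⇒x∧y≡y : ∀ {x y} → y ≤ x → x ∧ y ≡ y
  y≤x⇒x∧y≡y {x} {y} y≤x = trans (cong ¬_ (x≤y⇒x∨y≡y (¬-antitone y≤x))) (¬¬ y)

  x∧y≡y⇒y≤x : ∀ {x y} → Central x → Central y → x ∧ y ≡ y → y ≤ x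
  x∧y≡y⇒y≤x cx cy x∧y≡y =
    ¬-reflects-≤ (x∨y≡y⇒x≤y (central-¬ cx) (central-¬ cy) (trans (sym (¬¬ _)) (cong ¬_ x∧y≡y)))

  ∧-zeroʳ : ∀ x → x ∧ 𝟘 ≡ 𝟘
  ∧-zeroʳ x = y≤x⇒x∧y≡y (trans (cong (_⊕ x) ¬𝟘) (⊕-zeroˡ x))

  ∧≡⋀ : ∀ x y → x ∧ y ≡ x ⋀ y
  ∧≡⋀ x y = begin
    ¬ (¬ (¬ ¬ x ⊕ ¬ y) ⊕ ¬ y) ≡⟨ cong (λ t → ¬ (¬ (t ⊕ ¬ y) ⊕ ¬ y)) (¬¬ x) ⟩
    ¬ (¬ (x ⊕ ¬ y) ⊕ ¬ y)     ≡⟨ cong (λ t → ¬ (¬ t ⊕ ¬ y)) ¬[¬x⊙y]≡x⊕¬y ⟨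
    ¬ (¬ ¬ (¬ x ⊙ y) ⊕ ¬ y)   ≡⟨ ⊙-def _ y ⟨
    x ⋀ y                     ∎
    where
      ¬[¬x⊙y]≡x⊕¬y : ¬ (¬ x ⊙ y) ≡ x ⊕ ¬ y
      ¬[¬x⊙y]≡x⊕¬y = trans (¬-⊙ (¬ x) y) (cong (_⊕ ¬ y) (¬¬ x))

  ⊙≡𝟙⇒≡𝟙 : ∀ {x y} → Central x → x ⊙ y ≡ 𝟙 → x ≡ 𝟙
  ⊙≡𝟙⇒≡𝟙 {x} {y} cx x⊙y≡𝟙 = begin
    x                 ≡⟨ ⊕-identity x ⟨
    x ⊕ 𝟘             ≡⟨ cong (x ⊕_) ¬x⊕¬y≡𝟘 ⟨
    x ⊕ (¬ x ⊕ ¬ y)   ≡⟨ ⊕-assoc _ _ _ ⟩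
    (x ⊕ ¬ x) ⊕ ¬ y   ≡⟨ cong (_⊕ ¬ y) (trans (⊕-comm x (¬ x)) (¬x⊕x≡𝟙 cx)) ⟩
    𝟙 ⊕ ¬ y           ≡⟨ ⊕-zeroˡ _ ⟩
    𝟙                 ∎
    where
      ¬x⊕¬y≡𝟘 : ¬ x ⊕ ¬ y ≡ 𝟘
      ¬x⊕¬y≡𝟘 = trans (sym (¬-⊙ x y)) (trans (cong ¬_ x⊙y≡𝟙) ¬𝟙)

  ⊙≡𝟙⇔ : ∀ {x y} → Central x → Central y → (x ≡ 𝟙 × y ≡ 𝟙) ⇔ (x ⊙ y ≡ 𝟙)
  ⊙≡𝟙⇔ {x} {y} cx cy = mk⇔
    (λ (x≡𝟙 , y≡𝟙) → trans (cong₂ _⊙_ x≡𝟙 y≡𝟙) (⊙-identityʳ 𝟙))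
    (λ x⊙y≡𝟙 → ⊙≡𝟙⇒≡𝟙 cx x⊙y≡𝟙 , ⊙≡𝟙⇒≡𝟙 cy (trans (⊙-comm y x) x⊙y≡𝟙))


module UnionProperties {a : Level} (J : IMVAlgebra a)
    (_∪_ : IMVAlgebra.Carrier J → IMVAlgebra.Carrier J → IMVAlgebra.Carrier J)
    (isUnion : IMVOps.IsUnion J _∪_) where
  open IMVAlgebra J
  open IMVOps J
  open WithUnion _∪_
  open Properties J
  open ≡-Reasoning

  Δ-∪ : ∀ x y → Δ (x ∪ y) ≡ Δ x ∧ Δ y
  Δ-∪ x y = proj₁ (isUnion x y)

  ∇-∪ : ∀ x y → ∇ (x ∪ y) ≡ ∇ x ∨ ∇ y
  ∇-∪ x y = proj₂ (isUnion x y)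

  ⊆⇒Δ≤ : ∀ {x y} → x ⊆ y → Δ y ≤ Δ x
  ⊆⇒Δ≤ {x} {y} x⊆y = x∧y≡y⇒y≤x (ΔΔ x) (ΔΔ y) (trans (sym (Δ-∪ x y)) (cong Δ x⊆y))

  ⊆⇒∇≤ : ∀ {x y} → x ⊆ y → ∇ x ≤ ∇ y
  ⊆⇒∇≤ {x} {y} x⊆y = x∨y≡y⇒x≤y (Δ∇ x) (Δ∇ y) (trans (sym (∇-∪ x y)) (cong ∇ x⊆y))

  ≤⇒⊆ : ∀ {x y} → Δ y ≤ Δ x → ∇ x ≤ ∇ y → x ⊆ y
  ≤⇒⊆ {x} {y} Δy≤Δx ∇x≤∇y =
    Δ∇-injective (trans (Δ-∪ x y) (y≤x⇒x∧y≡y Δy≤Δx)) (trans (∇-∪ x y) (x≤y⇒x∨y≡y ∇x≤∇y))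

  ⊆⇔≤ : ∀ {x y} → x ⊆ y ⇔ (Δ y ≤ Δ x × ∇ x ≤ ∇ y)
  ⊆⇔≤ = mk⇔ (λ x⊆y → ⊆⇒Δ≤ x⊆y , ⊆⇒∇≤ x⊆y) (λ (Δy≤Δx , ∇x≤∇y) → ≤⇒⊆ Δy≤Δx ∇x≤∇y)

  ∪-assoc : ∀ x y z → x ∪ (y ∪ z) ≡ (x ∪ y) ∪ z
  ∪-assoc x y z = Δ∇-injective
    (begin
      Δ (x ∪ (y ∪ z))   ≡⟨ Δ-∪ x (y ∪ z) ⟩
      Δ x ∧ Δ (y ∪ z)   ≡⟨ cong (Δ x ∧_) (Δ-∪ y z) ⟩
      Δ x ∧ (Δ y ∧ Δ z) ≡⟨ ∧-assoc (ΔΔ x) (ΔΔ y) (ΔΔ z) ⟩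
      (Δ x ∧ Δ y) ∧ Δ z ≡⟨ cong (_∧ Δ z) (Δ-∪ x y) ⟨
      Δ (x ∪ y) ∧ Δ z   ≡⟨ Δ-∪ (x ∪ y) z ⟨
      Δ ((x ∪ y) ∪ z)   ∎)
    (begin
      ∇ (x ∪ (y ∪ z))   ≡⟨ ∇-∪ x (y ∪ z) ⟩
      ∇ x ∨ ∇ (y ∪ z)   ≡⟨ cong (∇ x ∨_) (∇-∪ y z) ⟩
      ∇ x ∨ (∇ y ∨ ∇ z) ≡⟨ ∨-assoc (Δ∇ x) (Δ∇ y) (Δ∇ z) ⟩
      (∇ x ∨ ∇ y) ∨ ∇ z ≡⟨ cong (_∨ ∇ z) (∇-∪ x y) ⟨
      ∇ (x ∪ y) ∨ ∇ z   ≡⟨ ∇-∪ (x ∪ y) z ⟨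
      ∇ ((x ∪ y) ∪ z)   ∎)

  ∪-comm : ∀ x y → x ∪ y ≡ y ∪ x
  ∪-comm x y = Δ∇-injective
    (trans (Δ-∪ x y) (trans (∧-comm (ΔΔ x) (ΔΔ y)) (sym (Δ-∪ y x))))
    (trans (∇-∪ x y) (trans (∨-comm (Δ∇ x) (Δ∇ y)) (sym (∇-∪ y x))))

  ∪-idem : ∀ x → x ∪ x ≡ x
  ∪-idem x = Δ∇-injective (trans (Δ-∪ x x) (∧-idem (ΔΔ x))) (trans (∇-∪ x x) (∨-idem (Δ∇ x)))

  x⊆ι : ∀ x → x ⊆ ι
  x⊆ι x = Δ∇-injective
    (trans (Δ-∪ x ι) (trans (cong (Δ x ∧_) Δι) (trans (∧-zeroʳ (Δ x)) (sym Δι))))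
    (trans (∇-∪ x ι) (trans (cong (∇ x ∨_) ∇ι) (trans (∨-zeroʳ (∇ x)) (sym ∇ι))))

  Δx⊆x : ∀ x → Δ x ⊆ x
  Δx⊆x x = ≤⇒⊆ (subst (Δ x ≤_) (sym (ΔΔ x)) (≤-refl (ΔΔ x)))
               (subst (_≤ ∇ x) (sym (central⇒∇≡ (ΔΔ x))) (Δ≤∇ x))

  ∇x⊆x : ∀ x → ∇ x ⊆ x
  ∇x⊆x x = ≤⇒⊆ (subst (Δ x ≤_) (sym (Δ∇ x)) (Δ≤∇ x))
               (subst (_≤ ∇ x) (sym (central⇒∇≡ (Δ∇ x))) (≤-refl (Δ∇ x)))

  minimal⇒inCenter : ∀ {x} → IsMinimal x → InCenter x
  minimal⇒inCenter {x} minimal =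
    trans (sym (central⇒∇≡ (ΔΔ x))) (cong ∇ (minimal (Δ x) (Δx⊆x x)))

  -- If y ⊆ x and Δ x = ∇ x then Δ x ≤ Δ y ≤ ∇ y ≤ ∇ x = Δ x, so all four coincide.
  inCenter⇒minimal : ∀ {x} → InCenter x → IsMinimal x
  inCenter⇒minimal {x} Δx≡∇x y y⊆x = Δ∇-injective
    (≤-antisym (ΔΔ y) (ΔΔ x) Δy≤Δx (⊆⇒Δ≤ y⊆x))
    (≤-antisym (Δ∇ y) (Δ∇ x) (⊆⇒∇≤ y⊆x) ∇x≤∇y)
    where
      Δy≤Δx : Δ y ≤ Δ x
      Δy≤Δx = ≤-trans (ΔΔ y) (Δ∇ y) (ΔΔ x) (Δ≤∇ y) (subst (∇ y ≤_) (sym Δx≡∇x) (⊆⇒∇≤ y⊆x))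
      ∇x≤∇y : ∇ x ≤ ∇ y
      ∇x≤∇y = subst (_≤ ∇ y) Δx≡∇x (≤-trans (ΔΔ x) (ΔΔ y) (Δ∇ y) (⊆⇒Δ≤ y⊆x) (Δ≤∇ y))

  minimal⇔inCenter : ∀ x → IsMinimal x ⇔ InCenter x
  minimal⇔inCenter x = mk⇔ minimal⇒inCenter inCenter⇒minimal

  ⊕-mono-⊆ : ∀ x x′ y y′ → x ⊆ x′ → y ⊆ y′ → x ⊕ y ⊆ x′ ⊕ y′
  ⊕-mono-⊆ x x′ y y′ x⊆x′ y⊆y′ = ≤⇒⊆
    (subst₂ _≤_ (sym (Δ-⊕ x′ y′)) (sym (Δ-⊕ x y))
      (⊕-mono-≤ (ΔΔ x′) (ΔΔ x) (ΔΔ y′) (ΔΔ y) (⊆⇒Δ≤ x⊆x′) (⊆⇒Δ≤ y⊆y′)))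
    (subst₂ _≤_ (sym (∇-⊕ x y)) (sym (∇-⊕ x′ y′))
      (⊕-mono-≤ (Δ∇ x) (Δ∇ x′) (Δ∇ y) (Δ∇ y′) (⊆⇒∇≤ x⊆x′) (⊆⇒∇≤ y⊆y′)))

  ⊙-mono-⊆ : ∀ x x′ y y′ → x ⊆ x′ → y ⊆ y′ → x ⊙ y ⊆ x′ ⊙ y′
  ⊙-mono-⊆ x x′ y y′ x⊆x′ y⊆y′ = ≤⇒⊆
    (subst₂ _≤_ (sym (Δ-⊙ x′ y′)) (sym (Δ-⊙ x y))
      (⊙-mono-≤ (ΔΔ x′) (ΔΔ x) (ΔΔ y′) (ΔΔ y) (⊆⇒Δ≤ x⊆x′) (⊆⇒Δ≤ y⊆y′)))
    (subst₂ _≤_ (sym (∇-⊙ x y)) (sym (∇-⊙ x′ y′))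
      (⊙-mono-≤ (Δ∇ x) (Δ∇ x′) (Δ∇ y) (Δ∇ y′) (⊆⇒∇≤ x⊆x′) (⊆⇒∇≤ y⊆y′)))

  ¬-mono-⊆ : ∀ x y → x ⊆ y → ¬ x ⊆ ¬ y
  ¬-mono-⊆ x y x⊆y = ≤⇒⊆
    (subst₂ _≤_ (sym (Δ-¬ y)) (sym (Δ-¬ x)) (¬-antitone (⊆⇒∇≤ x⊆y)))
    (subst₂ _≤_ (sym (∇-¬ x)) (sym (∇-¬ y)) (¬-antitone (⊆⇒Δ≤ x⊆y)))

  -- _⋁_ is literally _∨_, and ζ u v is the decomposition of an element with Δ = Δ u, ∇ = ∇ v.
  ∪≡ζ : ∀ x y → x ∪ y ≡ ζ (Δ x ⋀ Δ y) (∇ x ⋁ ∇ y)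
  ∪≡ζ x y = trans (sym (decomp (x ∪ y))) (cong₂ (λ p q → p ⊕ (ι ⊙ q ⊙ ¬ p)) Δ-eq ∇-eq)
    where
      central-⋀ : Central (Δ x ⋀ Δ y)
      central-⋀ = subst Central (∧≡⋀ (Δ x) (Δ y)) (central-∧ (ΔΔ x) (ΔΔ y))
      Δ-eq : Δ (x ∪ y) ≡ Δ (Δ x ⋀ Δ y)
      Δ-eq = trans (Δ-∪ x y) (trans (∧≡⋀ (Δ x) (Δ y)) (sym central-⋀))
      ∇-eq : ∇ (x ∪ y) ≡ ∇ (∇ x ⋁ ∇ y)
      ∇-eq = trans (∇-∪ x y) (sym (central⇒∇≡ (central-∨ (Δ∇ x) (Δ∇ y))))

  ≤×≤⇔⊙≡𝟙 : ∀ x y → (Δ y ≤ Δ x × ∇ x ≤ ∇ y) ⇔ ((¬ Δ y ⊕ Δ x) ⊙ (¬ ∇ x ⊕ ∇ y) ≡ 𝟙)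
  ≤×≤⇔⊙≡𝟙 x y = ⊙≡𝟙⇔ (central-⊕ (central-¬ (ΔΔ y)) (ΔΔ x)) (central-⊕ (central-¬ (Δ∇ x)) (Δ∇ y))

proposition5p6 : {a : Level} (J : IMVAlgebra a) →
    let open IMVAlgebra J
        open IMVOps J
    in (_∪_ : Carrier → Carrier → Carrier) → IsUnion _∪_ →
    let open WithUnion _∪_
    in
    ((∀ x y z → x ∪ (y ∪ z) ≡ (x ∪ y) ∪ z)
     × (∀ x y → x ∪ y ≡ y ∪ x)
     × (∀ x → x ∪ x ≡ x)
     × (∀ x → x ⊆ ι)
     × (∀ x → IsMinimal x ⇔ InCenter x))
    × ((∀ x x′ y y′ → x ⊆ x′ → y ⊆ y′ → (x ⊕ y) ⊆ (x′ ⊕ y′))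
     × (∀ x x′ y y′ → x ⊆ x′ → y ⊆ y′ → (x ⊙ y) ⊆ (x′ ⊙ y′))
     × (∀ x y → x ⊆ y → (¬ x) ⊆ (¬ y))
     × (∀ x → (Δ x ⊆ x) × (∇ x ⊆ x)))
    × (∀ x y → x ∪ y ≡ ζ (Δ x ⋀ Δ y) (∇ x ⋁ ∇ y))
    × (∀ x y → ((x ⊆ y) ⇔ (x ∪ y ≡ y))
             × ((x ∪ y ≡ y) ⇔ ((Δ y ≤ Δ x) × (∇ x ≤ ∇ y)))
             × (((Δ y ≤ Δ x) × (∇ x ≤ ∇ y))
                 ⇔ ((¬ (Δ y) ⊕ Δ x) ⊙ (¬ (∇ x) ⊕ ∇ y) ≡ 𝟙)))
proposition5p6 J _∪_ isUnion =
    (∪-assoc , ∪-comm , ∪-idem , x⊆ι , minimal⇔inCenter)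
  , (⊕-mono-⊆ , ⊙-mono-⊆ , ¬-mono-⊆ , (λ x → Δx⊆x x , ∇x⊆x x))
  , ∪≡ζ
  , (λ x y → mk⇔ id id , ⊆⇔≤ , ≤×≤⇔⊙≡𝟙 x y)
  where open UnionProperties J _∪_ isUnion
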